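{- Let $H$ be an endofunctor of a category $\mathcal A$ with finite coproducts, and let $Y$ be an object of $\mathcal A$. For an object $TY$ of $\mathcal A$ the following are equivalent: (1) $TY$ is (the carrier of) a final coalgebra for the functor $H(-)+Y$; (2) $TY$ is (the carrier of) a free complete Elgot algebra on $Y$.
   Context: Coproduct injections are $\mathrm{inl},\mathrm{inr}$. For an $H$-algebra $\alpha:HA\to A$, a flat equation morphism in $A$ is any morphism $e:X\to HX+A$; a solution is $e^\dagger:X\to A$ with $e^\dagger=[\alpha,\mathrm{id}_A]\cdot(He^\dagger+\mathrm{id}_A)\cdot e$. For $e:X\to HX+Y$ and $h:Y\to Z$, $h\bullet e:=(\mathrm{id}_{HX}+h)\cdot e$; for $e:X\to HX+Y$, $f:Y\to HY+A$, $f\oplus e:=(\mathrm{can}+\mathrm{id}_A)\cdot(\mathrm{id}_{HX}+f)\cdot[e,\mathrm{inr}]$ with $\mathrm{can}=[H\mathrm{inl},H\mathrm{inr}]$. A complete Elgot algebra is an $H$-algebra with an assignment $e\mapsto e^\dagger$ of a solution to every flat equation morphism that is functorial ($e^\dagger=f^\dagger\cdot h$ whenever $(Hh+\mathrm{id}_A)\cdot e=f\cdot h$) and compositional ($(f^\dagger\bullet e)^\dagger=(f\oplus e)^\dagger\cdot\mathrm{inl}$). A morphism $h:A\to B$ of complete Elgot algebras $(A,\alpha,(-)^\dagger)$, $(B,\beta,(-)^\ddagger)$ is solution-preserving if $h\cdot e^\dagger=(h\bullet e)^\ddagger$ for all flat equation morphisms $e$ in $A$. A free complete Elgot algebra on $Y$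 is a complete Elgot algebra $TY$ with a morphism $\eta_Y:Y\to TY$ such that for every complete Elgot algebra $A$ and morphism $m:Y\to A$ there is a unique solution-preserving $h:TY\to A$ with $h\cdot\eta_Y=m$. -}

module Defs where

open import Level using (Level; _⊔_; suc)
open import Data.Product using (Σ; _×_; _,_; ∃!)
open import Relation.Binary using (IsEquivalence)

record Category (o ℓ e : Level) : Set (suc (o ⊔ ℓ ⊔ e)) where
  infixr 9 _∘_
  infix  4 _≈_
  field
    Obj  : Set o
    Hom  : Obj → Obj → Set ℓ
    _≈_  : ∀ {A B} → Hom A B → Hom A B → Set e
    id   : ∀ {A} → Hom A A
    _∘_  : ∀ {A B C} → Hom B C → Hom A B → Hom A C
    equiv     : ∀ {A B} → IsEquivalence (_≈_ {A} {B})
    assoc     : ∀ {A B C D} {f : Hom A B} {g : Hom B C} {h : Hom C D} →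
                (h ∘ g) ∘ f ≈ h ∘ (g ∘ f)
    identityˡ : ∀ {A B} {f : Hom A B} → id ∘ f ≈ f
    identityʳ : ∀ {A B} {f : Hom A B} → f ∘ id ≈ f
    ∘-resp-≈  : ∀ {A B C} {f h : Hom B C} {g i : Hom A B} →
                f ≈ h → g ≈ i → f ∘ g ≈ h ∘ i

record Endofunctor {o ℓ e} (C : Category o ℓ e) : Set (o ⊔ ℓ ⊔ e) where
  open Category C
  field
    F₀ : Obj → Obj
    F₁ : ∀ {A B} → Hom A B → Hom (F₀ A) (F₀ B)
    identity     : ∀ {A} → F₁ (id {A}) ≈ id
    homomorphism : ∀ {A B C} {f : Hom A B} {g : Hom B C} →
                   F₁ (g ∘ f) ≈ F₁ g ∘ F₁ f
    F-resp-≈     : ∀ {A B} {f g : Hom A B} → f ≈ g → F₁ f ≈ F₁ g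

record FiniteCoproducts {o ℓ e} (C : Category o ℓ e) : Set (o ⊔ ℓ ⊔ e) where
  open Category C
  infixr 6 _+₀_
  field
    _+₀_ : Obj → Obj → Obj
    inl  : ∀ {A B} → Hom A (A +₀ B)
    inr  : ∀ {A B} → Hom B (A +₀ B)
    [_,_] : ∀ {A B X} → Hom A X → Hom B X → Hom (A +₀ B) X
    inl-β : ∀ {A B X} {f : Hom A X} {g : Hom B X} → [ f , g ] ∘ inl ≈ f
    inr-β : ∀ {A B X} {f : Hom A X} {g : Hom B X} → [ f , g ] ∘ inr ≈ g
    +-unique : ∀ {A B X} {f : Hom A X} {g : Hom B X} {h : Hom (A +₀ B) X} →
               h ∘ inl ≈ f → h ∘ inr ≈ g → h ≈ [ f , g ]
    ⊥₀   : Obj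
    ¡    : ∀ {X} → Hom ⊥₀ X
    ¡-unique : ∀ {X} (f : Hom ⊥₀ X) → f ≈ ¡

module Elgot {o ℓ e} (C : Category o ℓ e) (cop : FiniteCoproducts C)
             (H : Endofunctor C) where
  open Category C
  open FiniteCoproducts cop
  open Endofunctor H

  infixr 6 _+₁_
  _+₁_ : ∀ {A B A' B'} → Hom A A' → Hom B B' → Hom (A +₀ B) (A' +₀ B')
  f +₁ g = [ inl ∘ f , inr ∘ g ]

  IsCoalgHom : ∀ {Y X X'} (c : Hom X (F₀ X +₀ Y)) (c' : Hom X' (F₀ X' +₀ Y))
               → Hom X X' → Set e
  IsCoalgHom c c' h = c' ∘ h ≈ (F₁ h +₁ id) ∘ c

  IsFinalCoalgebra : (Y TY : Obj) → Hom TY (F₀ TY +₀ Y) → Set (o ⊔ ℓ ⊔ e)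
  IsFinalCoalgebra Y TY τ =
    ∀ (X : Obj) (c : Hom X (F₀ X +₀ Y)) → ∃! _≈_ (IsCoalgHom c τ)

  FinalCoalgebraCarrier : (Y TY : Obj) → Set (o ⊔ ℓ ⊔ e)
  FinalCoalgebraCarrier Y TY = Σ (Hom TY (F₀ TY +₀ Y)) (IsFinalCoalgebra Y TY)

  _•_ : ∀ {X Y Z} → Hom Y Z → Hom X (F₀ X +₀ Y) → Hom X (F₀ X +₀ Z)
  h • e = (id +₁ h) ∘ e

  can : ∀ {X Y} → Hom (F₀ X +₀ F₀ Y) (F₀ (X +₀ Y))
  can = [ F₁ inl , F₁ inr ]

  -- associativity iso  A + (B + C) → (A + B) + C (implicit in the paper)
  α⃗ : ∀ {A B D} → Hom (A +₀ (B +₀ D)) ((A +₀ B) +₀ D)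
  α⃗ = [ inl ∘ inl , [ inl ∘ inr , inr ] ]

  _⊕_ : ∀ {X Y A} → Hom Y (F₀ Y +₀ A) → Hom X (F₀ X +₀ Y)
        → Hom (X +₀ Y) (F₀ (X +₀ Y) +₀ A)
  f ⊕ e = (can +₁ id) ∘ α⃗ ∘ (id +₁ f) ∘ [ e , inr ]

  IsSolution : ∀ {A X} (α : Hom (F₀ A) A) → Hom X (F₀ X +₀ A) → Hom X A → Set e
  IsSolution α e s = s ≈ [ α , id ] ∘ (F₁ s +₁ id) ∘ e

  record CompleteElgot (A : Obj) : Set (o ⊔ ℓ ⊔ e) where
    field
      α     : Hom (F₀ A) A
      _†    : ∀ {X} → Hom X (F₀ X +₀ A) → Hom X A
      solution : ∀ {X} (e : Hom X (F₀ X +₀ A)) → IsSolution α e (e †)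
      functorial : ∀ {X Z} (e : Hom X (F₀ X +₀ A)) (f : Hom Z (F₀ Z +₀ A))
                   (h : Hom X Z) → (F₁ h +₁ id) ∘ e ≈ f ∘ h → e † ≈ (f †) ∘ h
      compositional : ∀ {X Y} (e : Hom X (F₀ X +₀ Y)) (f : Hom Y (F₀ Y +₀ A)) →
                      ((f †) • e) † ≈ ((f ⊕ e) †) ∘ inl

  open CompleteElgot

  IsSolutionPreserving : ∀ {A B} → CompleteElgot A → CompleteElgot B
                         → Hom A B → Set (o ⊔ ℓ ⊔ e)
  IsSolutionPreserving {A} 𝔸 𝔹 h =
    ∀ {X} (e : Hom X (F₀ X +₀ A)) → h ∘ (_† 𝔸 e) ≈ _† 𝔹 (h • e)

  IsFreeElgot : (Y TY : Obj) → CompleteElgot TY → Hom Y TY → Set (o ⊔ ℓ ⊔ e)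
  IsFreeElgot Y TY E η =
    ∀ (A : Obj) (𝔸 : CompleteElgot A) (m : Hom Y A) →
      ∃! _≈_ (λ h → IsSolutionPreserving E 𝔸 h × h ∘ η ≈ m)

  FreeElgotCarrier : (Y TY : Obj) → Set (o ⊔ ℓ ⊔ e)
  FreeElgotCarrier Y TY =
    Σ (CompleteElgot TY) λ E → Σ (Hom Y TY) λ η → IsFreeElgot Y TY E η

{-# OPTIONS --safe #-}
-- Both directions pass through one criterion: if a complete Elgot algebra T with η : Y → T
-- admits τ : T → H T + Y with τ ∘ [ α , η ] ≈ id and (η • τ) † ≈ id, then (T , τ) is a final
-- coalgebra, the unique homomorphism from c being (η • c) †, and (T , η) is free, the extension
-- of m being (m • τ) †.
-- A final coalgebra meets it: by Lambek's lemma τ is inverse to some [ α , η ], and a flat equation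
-- has exactly one solution, since solutions s of e correspond to coalgebra homomorphisms
-- [ s , id ] from a coalgebra on X + T; unique solutions always form a complete Elgot algebra.
-- A free algebra meets it: H T + Y carries a complete Elgot structure making [ α , η ]
-- solution-preserving, and the solution-preserving extension of inr is inverse to [ α , η ].
module Submission where

open import Data.Product using (_×_; _,_; proj₁; proj₂)
open import Function.Bundles using (_⇔_; mk⇔)
open import Relation.Binary.Bundles using (Setoid)
open import Relation.Binary.Structures using (IsEquivalence)
import Relation.Binary.Reasoning.Setoid as SetoidReasoning

open import Defs

module HomReasoning {o ℓ e} (C : Category o ℓ e) where
  open Category C

  hom-setoid : Obj → Obj → Setoid ℓ e
  hom-setoid A B = record { Carrier = Hom A B ; _≈_ = _≈_ ; isEquivalence = equiv }

  module _ {A B : Obj} where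
    open IsEquivalence (equiv {A} {B}) public
    open SetoidReasoning (hom-setoid A B) public

  infixr 4 refl⟩∘⟨_
  infixl 5 _⟩∘⟨refl

  refl⟩∘⟨_ : ∀ {A B D} {f : Hom B D} {g i : Hom A B} → g ≈ i → f ∘ g ≈ f ∘ i
  refl⟩∘⟨ p = ∘-resp-≈ refl p

  _⟩∘⟨refl : ∀ {A B D} {f h : Hom B D} {g : Hom A B} → f ≈ h → f ∘ g ≈ h ∘ g
  p ⟩∘⟨refl = ∘-resp-≈ p refl

  sym-assoc : ∀ {A B D E} {f : Hom A B} {g : Hom B D} {h : Hom D E} →
              h ∘ (g ∘ f) ≈ (h ∘ g) ∘ f
  sym-assoc = sym assoc

  pullˡ : ∀ {A B D E} {f : Hom D E} {g : Hom B D} {h : Hom B E} {k : Hom A B} →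
          f ∘ g ≈ h → f ∘ (g ∘ k) ≈ h ∘ k
  pullˡ p = trans sym-assoc (p ⟩∘⟨refl)

  pullʳ : ∀ {A B D E} {f : Hom B D} {g : Hom A B} {h : Hom A D} {k : Hom D E} →
          f ∘ g ≈ h → (k ∘ f) ∘ g ≈ k ∘ h
  pullʳ p = trans assoc (refl⟩∘⟨ p)

  cancelˡ : ∀ {A B D} {f : Hom B D} {g : Hom D B} {h : Hom A D} →
            f ∘ g ≈ id → f ∘ (g ∘ h) ≈ h
  cancelˡ p = trans (pullˡ p) identityˡ

module Coproducts {o ℓ e} {C : Category o ℓ e} (cop : FiniteCoproducts C) where
  open Category C
  open FiniteCoproducts cop
  open HomReasoning C

  -- Definitionally equal to Elgot._+₁_, which is parametrised by a functor it does not use.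
  infixr 6 _+₁_
  _+₁_ : ∀ {A B A' B'} → Hom A A' → Hom B B' → Hom (A +₀ B) (A' +₀ B')
  f +₁ g = [ inl ∘ f , inr ∘ g ]

  []-cong : ∀ {A B X} {f f' : Hom A X} {g g' : Hom B X} →
            f ≈ f' → g ≈ g' → [ f , g ] ≈ [ f' , g' ]
  []-cong p q = +-unique (trans inl-β p) (trans inr-β q)

  []-ext : ∀ {A B X} {h k : Hom (A +₀ B) X} →
           h ∘ inl ≈ k ∘ inl → h ∘ inr ≈ k ∘ inr → h ≈ k
  []-ext p q = trans (+-unique p q) (sym (+-unique refl refl))

  []-η : ∀ {A B} → [ inl {A} {B} , inr ] ≈ id
  []-η = sym (+-unique identityˡ identityˡ)

  ∘-[] : ∀ {A B X Z} {f : Hom A X} {g : Hom B X} {h : Hom X Z} →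
         h ∘ [ f , g ] ≈ [ h ∘ f , h ∘ g ]
  ∘-[] = +-unique (pullʳ inl-β) (pullʳ inr-β)

  []-∘-+₁ : ∀ {A B A' B' X} {f : Hom A' X} {g : Hom B' X} {h : Hom A A'} {k : Hom B B'} →
            [ f , g ] ∘ (h +₁ k) ≈ [ f ∘ h , g ∘ k ]
  []-∘-+₁ = trans ∘-[] ([]-cong (pullˡ inl-β) (pullˡ inr-β))

  []-∘-+₁id : ∀ {A A' B X} {f : Hom A' X} {g : Hom B X} {h : Hom A A'} →
              [ f , g ] ∘ (h +₁ id) ≈ [ f ∘ h , g ]
  []-∘-+₁id = trans []-∘-+₁ ([]-cong refl identityʳ)

  +₁-∘-+₁ : ∀ {A B A' B' A'' B''} {f : Hom A' A''} {g : Hom B' B''}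
              {h : Hom A A'} {k : Hom B B'} →
            (f +₁ g) ∘ (h +₁ k) ≈ (f ∘ h) +₁ (g ∘ k)
  +₁-∘-+₁ = trans []-∘-+₁ ([]-cong assoc assoc)

  +₁-cong : ∀ {A B A' B'} {f f' : Hom A A'} {g g' : Hom B B'} →
            f ≈ f' → g ≈ g' → f +₁ g ≈ f' +₁ g'
  +₁-cong p q = []-cong (refl⟩∘⟨ p) (refl⟩∘⟨ q)

  +₁-identity : ∀ {A B} → id {A} +₁ id {B} ≈ id
  +₁-identity = trans ([]-cong identityʳ identityʳ) []-η

  []-∘-id+₁ : ∀ {A B X} {f : Hom A X} {g : Hom B X} →
              [ f , id ] ∘ (id +₁ g) ≈ [ f , g ]
  []-∘-id+₁ = trans []-∘-+₁ ([]-cong identityʳ identityˡ)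

  +₁-interchange : ∀ {A A' B B'} {f : Hom A A'} {g : Hom B B'} →
                   (f +₁ id) ∘ (id +₁ g) ≈ (id +₁ g) ∘ (f +₁ id)
  +₁-interchange =
    trans +₁-∘-+₁ (trans (+₁-cong (trans identityʳ (sym identityˡ))
                                  (trans identityˡ (sym identityʳ)))
                         (sym +₁-∘-+₁))

module ElgotAlgebras {o ℓ e} {C : Category o ℓ e} (cop : FiniteCoproducts C)
                     (H : Endofunctor C) where
  open Category C
  open FiniteCoproducts cop
  open Endofunctor H
  open HomReasoning C
  open Coproducts cop
  open Elgot C cop H hiding (_+₁_)

  infix 30 _†[_]
  _†[_] : ∀ {A X} → Hom X (F₀ X +₀ A) → CompleteElgot A → Hom X A
  e †[ 𝔸 ] = CompleteElgot._† 𝔸 e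

  F₁-∘ : ∀ {A B D} {f : Hom B D} {g : Hom A B} → F₁ f ∘ F₁ g ≈ F₁ (f ∘ g)
  F₁-∘ = sym homomorphism

  F₁id+₁id : ∀ {A B} → F₁ (id {A}) +₁ id {B} ≈ id
  F₁id+₁id = trans (+₁-cong identity refl) +₁-identity

  F₁+₁id-∘ : ∀ {A B D E} {f : Hom B D} {g : Hom A B} →
             (F₁ f +₁ id {E}) ∘ (F₁ g +₁ id) ≈ F₁ (f ∘ g) +₁ id
  F₁+₁id-∘ = trans +₁-∘-+₁ (+₁-cong F₁-∘ identityˡ)

  F₁+₁id-cancelˡ : ∀ {A B D E} {g : Hom B A} {h : Hom A B} {f : Hom D (F₀ A +₀ E)} →
                   g ∘ h ≈ id → (F₁ g +₁ id) ∘ ((F₁ h +₁ id) ∘ f) ≈ f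
  F₁+₁id-cancelˡ p =
    trans (pullˡ F₁+₁id-∘) (trans (trans (+₁-cong (F-resp-≈ p) refl) F₁id+₁id ⟩∘⟨refl) identityˡ)

  •-cong : ∀ {X Y Z} {h h' : Hom Y Z} {e : Hom X (F₀ X +₀ Y)} → h ≈ h' → h • e ≈ h' • e
  •-cong p = +₁-cong refl p ⟩∘⟨refl

  •-∘ : ∀ {X Y Z W} {u : Hom Z W} {h : Hom Y Z} {e : Hom X (F₀ X +₀ Y)} →
        u • (h • e) ≈ (u ∘ h) • e
  •-∘ = trans sym-assoc (trans +₁-∘-+₁ (+₁-cong identityˡ refl) ⟩∘⟨refl)

  F₁+₁id-∘-• : ∀ {X X' Y Z} {h : Hom X X'} {k : Hom Y Z} {e : Hom X (F₀ X +₀ Y)} →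
               (F₁ h +₁ id) ∘ (k • e) ≈ (id +₁ k) ∘ ((F₁ h +₁ id) ∘ e)
  F₁+₁id-∘-• = trans sym-assoc (trans (+₁-interchange ⟩∘⟨refl) assoc)

  ⊕-unfold : ∀ {X Y A} {f : Hom Y (F₀ Y +₀ A)} {e : Hom X (F₀ X +₀ Y)} →
             f ⊕ e ≈ [ inl ∘ F₁ inl , (F₁ inr +₁ id) ∘ f ] ∘ [ e , inr ]
  ⊕-unfold {f = f} {e} = begin
    (can +₁ id) ∘ (α⃗ ∘ ((id +₁ f) ∘ [ e , inr ])) ≈⟨ refl⟩∘⟨ sym-assoc ⟩
    (can +₁ id) ∘ ((α⃗ ∘ (id +₁ f)) ∘ [ e , inr ]) ≈⟨ trans sym-assoc (body ⟩∘⟨refl) ⟩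
    [ inl ∘ F₁ inl , (F₁ inr +₁ id) ∘ f ] ∘ [ e , inr ] ∎
    where
    body : (can +₁ id) ∘ (α⃗ ∘ (id +₁ f)) ≈ [ inl ∘ F₁ inl , (F₁ inr +₁ id) ∘ f ]
    body = trans (refl⟩∘⟨ []-∘-+₁) (trans ∘-[] ([]-cong
      (begin
        (can +₁ id) ∘ ((inl ∘ inl) ∘ id) ≈⟨ refl⟩∘⟨ identityʳ ⟩
        (can +₁ id) ∘ (inl ∘ inl)        ≈⟨ pullˡ inl-β ⟩
        (inl ∘ can) ∘ inl                ≈⟨ pullʳ inl-β ⟩
        inl ∘ F₁ inl                     ∎)
      (begin
        (can +₁ id) ∘ ([ inl ∘ inr , inr ] ∘ f) ≈⟨ sym-assoc ⟩
        ((can +₁ id) ∘ [ inl ∘ inr , inr ]) ∘ f ≈⟨ trans ∘-[] ([]-cong (pullˡ inl-β) inr-β) ⟩∘⟨refl ⟩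
        [ (inl ∘ can) ∘ inr , inr ∘ id ] ∘ f     ≈⟨ []-cong (pullʳ inr-β) refl ⟩∘⟨refl ⟩
        (F₁ inr +₁ id) ∘ f                       ∎)))

  ⊕-inl : ∀ {X Y A} {f : Hom Y (F₀ Y +₀ A)} {e : Hom X (F₀ X +₀ Y)} →
          (f ⊕ e) ∘ inl ≈ [ inl ∘ F₁ inl , (F₁ inr +₁ id) ∘ f ] ∘ e
  ⊕-inl = trans (⊕-unfold ⟩∘⟨refl) (pullʳ inl-β)

  ⊕-inr : ∀ {X Y A} {f : Hom Y (F₀ Y +₀ A)} {e : Hom X (F₀ X +₀ Y)} →
          (f ⊕ e) ∘ inr ≈ (F₁ inr +₁ id) ∘ f
  ⊕-inr = trans (⊕-unfold ⟩∘⟨refl) (trans (pullʳ inr-β) inr-β)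

  •-⊕ : ∀ {X Y A B} {u : Hom A B} {f : Hom Y (F₀ Y +₀ A)} {e : Hom X (F₀ X +₀ Y)} →
        u • (f ⊕ e) ≈ (u • f) ⊕ e
  •-⊕ {u = u} {f} {e} = []-ext
    (begin
      (u • (f ⊕ e)) ∘ inl                                     ≈⟨ trans (pullʳ ⊕-inl) sym-assoc ⟩
      ((id +₁ u) ∘ [ inl ∘ F₁ inl , (F₁ inr +₁ id) ∘ f ]) ∘ e ≈⟨ trans ∘-[] components ⟩∘⟨refl ⟩
      [ inl ∘ F₁ inl , (F₁ inr +₁ id) ∘ (u • f) ] ∘ e         ≈⟨ ⊕-inl ⟨
      ((u • f) ⊕ e) ∘ inl                                     ∎)
    (trans (pullʳ ⊕-inr) (trans (sym F₁+₁id-∘-•) (sym ⊕-inr)))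
    where
    components : [ (id +₁ u) ∘ (inl ∘ F₁ inl) , (id +₁ u) ∘ ((F₁ inr +₁ id) ∘ f) ]
               ≈ [ inl ∘ F₁ inl , (F₁ inr +₁ id) ∘ (u • f) ]
    components = []-cong (trans (pullˡ inl-β) (identityʳ ⟩∘⟨refl)) (sym F₁+₁id-∘-•)

  module _ {A} {α : Hom (F₀ A) A} where

    solution-unfold : ∀ {X} {e : Hom X (F₀ X +₀ A)} {s : Hom X A} →
                      IsSolution α e s → s ≈ [ α ∘ F₁ s , id ] ∘ e
    solution-unfold p = trans p (trans sym-assoc ([]-∘-+₁id ⟩∘⟨refl))

    solution-fold : ∀ {X} {e : Hom X (F₀ X +₀ A)} {s : Hom X A} →
                    s ≈ [ α ∘ F₁ s , id ] ∘ e → IsSolution α e s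
    solution-fold p = trans p (trans (sym []-∘-+₁id ⟩∘⟨refl) assoc)

    solution-resp : ∀ {X} {e e' : Hom X (F₀ X +₀ A)} {s : Hom X A} →
                    e ≈ e' → IsSolution α e s → IsSolution α e' s
    solution-resp p q = trans q (refl⟩∘⟨ refl⟩∘⟨ p)

    solution-∘ : ∀ {X Z} {e : Hom X (F₀ X +₀ A)} {f : Hom Z (F₀ Z +₀ A)}
                   {h : Hom X Z} {s : Hom Z A} →
                 (F₁ h +₁ id) ∘ e ≈ f ∘ h → IsSolution α f s → IsSolution α e (s ∘ h)
    solution-∘ {e = e} {f} {h} {s} p q = solution-fold (begin
      s ∘ h                                      ≈⟨ solution-unfold q ⟩∘⟨refl ⟩
      ([ α ∘ F₁ s , id ] ∘ f) ∘ h                ≈⟨ pullʳ (sym p) ⟩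
      [ α ∘ F₁ s , id ] ∘ ((F₁ h +₁ id) ∘ e)     ≈⟨ trans sym-assoc ([]-∘-+₁id ⟩∘⟨refl) ⟩
      [ (α ∘ F₁ s) ∘ F₁ h , id ] ∘ e             ≈⟨ []-cong (pullʳ F₁-∘) refl ⟩∘⟨refl ⟩
      [ α ∘ F₁ (s ∘ h) , id ] ∘ e                ∎)

    solution-⊕-inr : ∀ {X Y} {f : Hom Y (F₀ Y +₀ A)} {e : Hom X (F₀ X +₀ Y)}
                       {g : Hom (X +₀ Y) A} →
                     IsSolution α (f ⊕ e) g → IsSolution α f (g ∘ inr)
    solution-⊕-inr = solution-∘ (sym ⊕-inr)

    solution-⊕-inl : ∀ {X Y} {f : Hom Y (F₀ Y +₀ A)} {e : Hom X (F₀ X +₀ Y)}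
                       {g : Hom (X +₀ Y) A} →
                     IsSolution α (f ⊕ e) g → IsSolution α ((g ∘ inr) • e) (g ∘ inl)
    solution-⊕-inl {f = f} {e} {g} p = solution-fold (begin
      g ∘ inl
        ≈⟨ solution-unfold p ⟩∘⟨refl ⟩
      ([ α ∘ F₁ g , id ] ∘ (f ⊕ e)) ∘ inl
        ≈⟨ trans (pullʳ ⊕-inl) sym-assoc ⟩
      ([ α ∘ F₁ g , id ] ∘ [ inl ∘ F₁ inl , (F₁ inr +₁ id) ∘ f ]) ∘ e
        ≈⟨ trans ∘-[] ([]-cong on-inl on-inr) ⟩∘⟨refl ⟩
      [ α ∘ F₁ (g ∘ inl) , g ∘ inr ] ∘ e
        ≈⟨ pullˡ []-∘-id+₁ ⟨
      [ α ∘ F₁ (g ∘ inl) , id ] ∘ ((g ∘ inr) • e) ∎)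
      where
      on-inl : [ α ∘ F₁ g , id ] ∘ (inl ∘ F₁ inl) ≈ α ∘ F₁ (g ∘ inl)
      on-inl = trans (pullˡ inl-β) (pullʳ F₁-∘)
      on-inr : [ α ∘ F₁ g , id ] ∘ ((F₁ inr +₁ id) ∘ f) ≈ g ∘ inr
      on-inr = trans sym-assoc (trans ([]-∘-+₁id ⟩∘⟨refl)
                (trans ([]-cong (pullʳ F₁-∘) refl ⟩∘⟨refl)
                  (sym (solution-unfold (solution-⊕-inr p)))))

  module _ {A} (𝔸 : CompleteElgot A) where
    open CompleteElgot 𝔸

    †-cong : ∀ {X} {e e' : Hom X (F₀ X +₀ A)} → e ≈ e' → e † ≈ e' †
    †-cong {e = e} {e'} p = trans (functorial e e' id (begin
      (F₁ id +₁ id) ∘ e ≈⟨ F₁id+₁id ⟩∘⟨refl ⟩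
      id ∘ e            ≈⟨ identityˡ ⟩
      e                 ≈⟨ p ⟩
      e'                ≈⟨ identityʳ ⟨
      e' ∘ id           ∎)) identityʳ

    †-inr : ∀ {Y} {m : Hom Y A} → (inr ∘ m) † ≈ m
    †-inr {m = m} =
      trans (solution-unfold (solution (inr ∘ m))) (trans (pullˡ inr-β) identityˡ)

    †-⊕-inr : ∀ {X Y} {f : Hom Y (F₀ Y +₀ A)} {e : Hom X (F₀ X +₀ Y)} →
              (f ⊕ e) † ∘ inr ≈ f †
    †-⊕-inr {f = f} {e} = sym (functorial f (f ⊕ e) inr (sym ⊕-inr))

    preserves-id : IsSolutionPreserving 𝔸 𝔸 id
    preserves-id e = trans identityˡ (†-cong (sym (trans (+₁-identity ⟩∘⟨refl) identityˡ)))

  preserves-∘ : ∀ {A B D} (𝔸 : CompleteElgot A) (𝔹 : CompleteElgot B) (𝔻 : CompleteElgot D)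
                {g : Hom B D} {h : Hom A B} →
                IsSolutionPreserving 𝔹 𝔻 g → IsSolutionPreserving 𝔸 𝔹 h →
                IsSolutionPreserving 𝔸 𝔻 (g ∘ h)
  preserves-∘ 𝔸 𝔹 𝔻 preserves-g preserves-h e =
    trans (pullʳ (preserves-h e)) (trans (preserves-g _) (†-cong 𝔻 •-∘))

  layer : ∀ {A Z} → Hom A Z → Hom (F₀ A +₀ A) (F₀ (F₀ A +₀ A) +₀ Z)
  layer g = [ inl ∘ F₁ inr , inr ∘ g ]

  layer-solution : ∀ {A Z} {ζ : Hom (F₀ Z) Z} {g : Hom A Z} {s : Hom (F₀ A +₀ A) Z} →
                   IsSolution ζ (layer g) s → s ∘ inl ≈ ζ ∘ F₁ g
  layer-solution {ζ = ζ} {g} {s} p = begin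
    s ∘ inl                                     ≈⟨ s-unfold ⟩∘⟨refl ⟩
    [ (ζ ∘ F₁ s) ∘ F₁ inr , g ] ∘ inl           ≈⟨ trans inl-β (pullʳ F₁-∘) ⟩
    ζ ∘ F₁ (s ∘ inr)                            ≈⟨ refl⟩∘⟨ F-resp-≈ (trans (s-unfold ⟩∘⟨refl) inr-β) ⟩
    ζ ∘ F₁ g                                    ∎
    where
    s-unfold : s ≈ [ (ζ ∘ F₁ s) ∘ F₁ inr , g ]
    s-unfold = trans (solution-unfold p)
                     (trans ∘-[] ([]-cong (pullˡ inl-β) (trans (pullˡ inr-β) identityˡ)))

  •-layer : ∀ {A Z W} {h : Hom Z W} {g : Hom A Z} → h • layer g ≈ layer (h ∘ g)
  •-layer =
    trans ∘-[] ([]-cong (trans (pullˡ inl-β) (identityʳ ⟩∘⟨refl)) (trans (pullˡ inr-β) assoc))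

  preserves⇒homomorphism : ∀ {A B} (𝔸 : CompleteElgot A) (𝔹 : CompleteElgot B)
                             {h : Hom A B} →
                           IsSolutionPreserving 𝔸 𝔹 h →
                           h ∘ CompleteElgot.α 𝔸 ≈ CompleteElgot.α 𝔹 ∘ F₁ h
  preserves⇒homomorphism 𝔸 𝔹 {h} preserves = begin
    h ∘ α 𝔸                            ≈⟨ refl⟩∘⟨ α-as-solution ⟨
    h ∘ (layer id †[ 𝔸 ] ∘ inl)        ≈⟨ trans sym-assoc (preserves (layer id) ⟩∘⟨refl) ⟩
    (h • layer id) †[ 𝔹 ] ∘ inl        ≈⟨ layer-solution (solution-resp •-layer (solution 𝔹 _)) ⟩
    α 𝔹 ∘ F₁ (h ∘ id)                  ≈⟨ refl⟩∘⟨ F-resp-≈ identityʳ ⟩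
    α 𝔹 ∘ F₁ h                         ∎
    where
    open CompleteElgot
    α-as-solution : layer id †[ 𝔸 ] ∘ inl ≈ α 𝔸
    α-as-solution =
      trans (layer-solution (solution 𝔸 _)) (trans (refl⟩∘⟨ identity) identityʳ)

  -- [ e † , id ] is a morphism of equations from f ⊕ e to f, so by functoriality
  -- (f ⊕ e) † ≈ f † ∘ [ e † , id ], and compositionality does the rest.
  †-preserves-solutions : ∀ {T A} (𝕋 : CompleteElgot T) (𝔸 : CompleteElgot A)
                          {f : Hom T (F₀ T +₀ A)} →
                          f ∘ CompleteElgot.α 𝕋 ≈ inl → IsSolutionPreserving 𝕋 𝔸 (f †[ 𝔸 ])
  †-preserves-solutions 𝕋 𝔸 {f} f∘α≈inl e = sym (begin
    (f †[ 𝔸 ] • e) †[ 𝔸 ] ≈⟨ compositional 𝔸 e f ⟩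
    (f ⊕ e) †[ 𝔸 ] ∘ inl  ≈⟨ functorial 𝔸 (f ⊕ e) f k k-morphism ⟩∘⟨refl ⟩
    (f †[ 𝔸 ] ∘ k) ∘ inl  ≈⟨ pullʳ inl-β ⟩
    f †[ 𝔸 ] ∘ s          ∎)
    where
    open CompleteElgot
    s = e †[ 𝕋 ]
    k = [ s , id ]

    on-inl : (F₁ k +₁ id) ∘ (inl ∘ F₁ inl) ≈ inl ∘ F₁ s
    on-inl = trans (pullˡ inl-β) (trans (pullʳ F₁-∘) (refl⟩∘⟨ F-resp-≈ inl-β))

    f∘α∘F₁s : f ∘ (α 𝕋 ∘ F₁ s) ≈ inl ∘ F₁ s
    f∘α∘F₁s = trans sym-assoc (f∘α≈inl ⟩∘⟨refl)

    k-morphism : (F₁ k +₁ id) ∘ (f ⊕ e) ≈ f ∘ k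
    k-morphism = []-ext
      (begin
        ((F₁ k +₁ id) ∘ (f ⊕ e)) ∘ inl
          ≈⟨ trans (pullʳ ⊕-inl) sym-assoc ⟩
        ((F₁ k +₁ id) ∘ [ inl ∘ F₁ inl , (F₁ inr +₁ id) ∘ f ]) ∘ e
          ≈⟨ trans ∘-[] ([]-cong on-inl (F₁+₁id-cancelˡ inr-β)) ⟩∘⟨refl ⟩
        [ inl ∘ F₁ s , f ] ∘ e
          ≈⟨ trans ∘-[] ([]-cong f∘α∘F₁s identityʳ) ⟩∘⟨refl ⟨
        (f ∘ [ α 𝕋 ∘ F₁ s , id ]) ∘ e
          ≈⟨ pullʳ (sym (solution-unfold (solution 𝕋 e))) ⟩
        f ∘ s
          ≈⟨ pullʳ inl-β ⟨
        (f ∘ k) ∘ inl ∎)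
      (begin
        ((F₁ k +₁ id) ∘ (f ⊕ e)) ∘ inr      ≈⟨ pullʳ ⊕-inr ⟩
        (F₁ k +₁ id) ∘ ((F₁ inr +₁ id) ∘ f) ≈⟨ F₁+₁id-cancelˡ inr-β ⟩
        f                                   ≈⟨ trans (pullʳ inr-β) identityʳ ⟨
        (f ∘ k) ∘ inr                       ∎)

  module CompleteIterative {A} (α : Hom (F₀ A) A)
           (_‡ : ∀ {X} → Hom X (F₀ X +₀ A) → Hom X A)
           (‡-solution : ∀ {X} (e : Hom X (F₀ X +₀ A)) → IsSolution α e (e ‡))
           (‡-unique : ∀ {X} {e : Hom X (F₀ X +₀ A)} {s : Hom X A} →
                       IsSolution α e s → s ≈ e ‡) where

    ‡-functorial : ∀ {X Z} (e : Hom X (F₀ X +₀ A)) (f : Hom Z (F₀ Z +₀ A)) (h : Hom X Z) →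
                   (F₁ h +₁ id) ∘ e ≈ f ∘ h → e ‡ ≈ f ‡ ∘ h
    ‡-functorial e f h p = sym (‡-unique (solution-∘ p (‡-solution f)))

    ‡-compositional : ∀ {X Y} (e : Hom X (F₀ X +₀ Y)) (f : Hom Y (F₀ Y +₀ A)) →
                      ((f ‡) • e) ‡ ≈ (f ⊕ e) ‡ ∘ inl
    ‡-compositional e f =
      sym (‡-unique (solution-resp (•-cong ⊕‡∘inr) (solution-⊕-inl (‡-solution (f ⊕ e)))))
      where
      ⊕‡∘inr : (f ⊕ e) ‡ ∘ inr ≈ f ‡
      ⊕‡∘inr = ‡-unique (solution-⊕-inr (‡-solution (f ⊕ e)))

    elgot : CompleteElgot A
    elgot = record { α = α ; _† = _‡ ; solution = ‡-solution
                   ; functorial = ‡-functorial ; compositional = ‡-compositional }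

  module Unrolled {A Y} (𝔸 : CompleteElgot A) (η : Hom Y A) where
    open CompleteElgot 𝔸

    roll : Hom (F₀ A +₀ Y) A
    roll = [ α , η ]

    β : Hom (F₀ (F₀ A +₀ Y)) (F₀ A +₀ Y)
    β = inl ∘ F₁ roll

    β-∘-F₁ : ∀ {X} {t : Hom X (F₀ A +₀ Y)} → β ∘ F₁ t ≈ inl ∘ F₁ (roll ∘ t)
    β-∘-F₁ = pullʳ F₁-∘

    _‡ : ∀ {X} → Hom X (F₀ X +₀ (F₀ A +₀ Y)) → Hom X (F₀ A +₀ Y)
    e ‡ = [ inl ∘ F₁ ((roll • e) †) , id ] ∘ e

    roll-‡ : ∀ {X} {e : Hom X (F₀ X +₀ (F₀ A +₀ Y))} → roll ∘ e ‡ ≈ (roll • e) †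
    roll-‡ {e = e} = begin
      roll ∘ ([ inl ∘ F₁ s , id ] ∘ e)   ≈⟨ pullˡ (trans ∘-[] ([]-cong (pullˡ inl-β) identityʳ)) ⟩
      [ α ∘ F₁ s , roll ] ∘ e            ≈⟨ pullˡ []-∘-id+₁ ⟨
      [ α ∘ F₁ s , id ] ∘ (roll • e)     ≈⟨ solution-unfold (solution (roll • e)) ⟨
      s                                  ∎
      where s = (roll • e) †

    ‡-solution : ∀ {X} (e : Hom X (F₀ X +₀ (F₀ A +₀ Y))) → IsSolution β e (e ‡)
    ‡-solution e =
      solution-fold ([]-cong (trans (refl⟩∘⟨ F-resp-≈ (sym roll-‡)) (sym β-∘-F₁)) refl ⟩∘⟨refl)

    ‡-unique : ∀ {X} {e : Hom X (F₀ X +₀ (F₀ A +₀ Y))} {s : Hom X (F₀ A +₀ Y)} →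
               IsSolution β e s → roll ∘ s ≈ (roll • e) † → s ≈ e ‡
    ‡-unique p q =
      trans (solution-unfold p) ([]-cong (trans β-∘-F₁ (refl⟩∘⟨ F-resp-≈ q)) refl ⟩∘⟨refl)

    ‡-functorial : ∀ {X Z} (e : Hom X (F₀ X +₀ (F₀ A +₀ Y)))
                   (f : Hom Z (F₀ Z +₀ (F₀ A +₀ Y))) (h : Hom X Z) →
                   (F₁ h +₁ id) ∘ e ≈ f ∘ h → e ‡ ≈ f ‡ ∘ h
    ‡-functorial e f h p = sym (‡-unique (solution-∘ p (‡-solution f)) (begin
      roll ∘ (f ‡ ∘ h)     ≈⟨ pullˡ roll-‡ ⟩
      (roll • f) † ∘ h     ≈⟨ functorial (roll • e) (roll • f) h morphism ⟨
      (roll • e) †         ∎))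
      where
      morphism : (F₁ h +₁ id) ∘ (roll • e) ≈ (roll • f) ∘ h
      morphism = trans F₁+₁id-∘-• (trans (refl⟩∘⟨ p) sym-assoc)

    ‡-compositional : ∀ {X Z} (e : Hom X (F₀ X +₀ Z)) (f : Hom Z (F₀ Z +₀ (F₀ A +₀ Y))) →
                      ((f ‡) • e) ‡ ≈ (f ⊕ e) ‡ ∘ inl
    ‡-compositional e f = sym (‡-unique
      (solution-resp (•-cong ⊕‡∘inr) (solution-⊕-inl (‡-solution (f ⊕ e))))
      (begin
        roll ∘ ((f ⊕ e) ‡ ∘ inl) ≈⟨ pullˡ roll-⊕‡ ⟩
        ((roll • f) ⊕ e) † ∘ inl ≈⟨ compositional e (roll • f) ⟨
        (((roll • f) †) • e) †   ≈⟨ †-cong 𝔸 (trans (•-cong (sym roll-‡)) (sym •-∘)) ⟩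
        (roll • ((f ‡) • e)) †   ∎))
      where
      roll-⊕‡ : roll ∘ (f ⊕ e) ‡ ≈ ((roll • f) ⊕ e) †
      roll-⊕‡ = trans roll-‡ (†-cong 𝔸 •-⊕)
      ⊕‡∘inr : (f ⊕ e) ‡ ∘ inr ≈ f ‡
      ⊕‡∘inr = ‡-unique (solution-⊕-inr (‡-solution (f ⊕ e)))
                        (trans (pullˡ roll-⊕‡) (†-⊕-inr 𝔸))

    unrolled : CompleteElgot (F₀ A +₀ Y)
    unrolled = record { α = β ; _† = _‡ ; solution = ‡-solution
                      ; functorial = ‡-functorial ; compositional = ‡-compositional }

    roll-preserves : IsSolutionPreserving unrolled 𝔸 roll
    roll-preserves e = roll-‡

  module Retraction {T Y} (𝕋 : CompleteElgot T) (η : Hom Y T) (τ : Hom T (F₀ T +₀ Y))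
                 (τ-retracts : τ ∘ [ CompleteElgot.α 𝕋 , η ] ≈ id) where
    open CompleteElgot 𝕋

    τ∘α : τ ∘ α ≈ inl
    τ∘α = trans (refl⟩∘⟨ sym inl-β) (trans (pullˡ τ-retracts) identityˡ)

    τ∘η : τ ∘ η ≈ inr
    τ∘η = trans (refl⟩∘⟨ sym inr-β) (trans (pullˡ τ-retracts) identityˡ)

    extend : ∀ {A} → CompleteElgot A → Hom Y A → Hom T A
    extend 𝔸 m = (m • τ) †[ 𝔸 ]

    extend-preserves : ∀ {A} (𝔸 : CompleteElgot A) (m : Hom Y A) →
                       IsSolutionPreserving 𝕋 𝔸 (extend 𝔸 m)
    extend-preserves 𝔸 m =
      †-preserves-solutions 𝕋 𝔸 (trans (pullʳ τ∘α) (trans inl-β identityʳ))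

    extend-∘-η : ∀ {A} (𝔸 : CompleteElgot A) (m : Hom Y A) → extend 𝔸 m ∘ η ≈ m
    extend-∘-η 𝔸 m =
      trans (sym (CompleteElgot.functorial 𝔸 (inr ∘ m) (m • τ) η morphism)) (†-inr 𝔸)
      where
      morphism : (F₁ η +₁ id) ∘ (inr ∘ m) ≈ (m • τ) ∘ η
      morphism = trans (trans (pullˡ inr-β) (identityʳ ⟩∘⟨refl))
                       (sym (trans (pullʳ τ∘η) inr-β))

    module _ (η•τ†≈id : (η • τ) † ≈ id) where

      extend-unique : ∀ {A} (𝔸 : CompleteElgot A) {k : Hom T A} →
                      IsSolutionPreserving 𝕋 𝔸 k → k ≈ extend 𝔸 (k ∘ η)
      extend-unique 𝔸 {k} preserves = begin
        k                         ≈⟨ trans (refl⟩∘⟨ η•τ†≈id) identityʳ ⟨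
        k ∘ (η • τ) †             ≈⟨ preserves (η • τ) ⟩
        (k • (η • τ)) †[ 𝔸 ]      ≈⟨ †-cong 𝔸 •-∘ ⟩
        ((k ∘ η) • τ) †[ 𝔸 ]      ∎

      free : IsFreeElgot Y T 𝕋 η
      free A 𝔸 m = extend 𝔸 m , (extend-preserves 𝔸 m , extend-∘-η 𝔸 m) , unique
        where
        unique : ∀ {k} → IsSolutionPreserving 𝕋 𝔸 k × k ∘ η ≈ m → extend 𝔸 m ≈ k
        unique (preserves , k∘η≈m) =
          sym (trans (extend-unique 𝔸 preserves) (†-cong 𝔸 (•-cong k∘η≈m)))

      final : IsFinalCoalgebra Y T τ
      final X c = s , s-homomorphism , s-unique
        where
        s = (η • c) †

        s-unfold : s ≈ [ α , η ] ∘ ((F₁ s +₁ id) ∘ c)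
        s-unfold = begin
          s                                     ≈⟨ solution-unfold (solution (η • c)) ⟩
          [ α ∘ F₁ s , id ] ∘ ((id +₁ η) ∘ c)   ≈⟨ pullˡ []-∘-id+₁ ⟩
          [ α ∘ F₁ s , η ] ∘ c                  ≈⟨ pullˡ []-∘-+₁id ⟨
          [ α , η ] ∘ ((F₁ s +₁ id) ∘ c)        ∎

        s-homomorphism : IsCoalgHom c τ s
        s-homomorphism = trans (refl⟩∘⟨ s-unfold) (cancelˡ τ-retracts)

        s-unique : ∀ {g} → IsCoalgHom c τ g → s ≈ g
        s-unique {g} g-homomorphism =
          trans (functorial (η • c) (η • τ) g morphism) (trans (η•τ†≈id ⟩∘⟨refl) identityˡ)
          where
          morphism : (F₁ g +₁ id) ∘ (η • c) ≈ (η • τ) ∘ g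
          morphism = trans F₁+₁id-∘-• (trans (refl⟩∘⟨ sym g-homomorphism) sym-assoc)

  module FinalCoalgebra {Y T} (τ : Hom T (F₀ T +₀ Y)) (isFinal : IsFinalCoalgebra Y T τ) where

    unfold : ∀ {X} → Hom X (F₀ X +₀ Y) → Hom X T
    unfold c = proj₁ (isFinal _ c)

    unfold-homomorphism : ∀ {X} (c : Hom X (F₀ X +₀ Y)) → IsCoalgHom c τ (unfold c)
    unfold-homomorphism c = proj₁ (proj₂ (isFinal _ c))

    homomorphism-unique : ∀ {X} {c : Hom X (F₀ X +₀ Y)} {g g' : Hom X T} →
                          IsCoalgHom c τ g → IsCoalgHom c τ g' → g ≈ g'
    homomorphism-unique {c = c} p q =
      trans (sym (proj₂ (proj₂ (isFinal _ c)) p)) (proj₂ (proj₂ (isFinal _ c)) q)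

    id-homomorphism : IsCoalgHom τ τ id
    id-homomorphism = trans identityʳ (sym (trans (F₁id+₁id ⟩∘⟨refl) identityˡ))

    roll : Hom (F₀ T +₀ Y) T
    roll = unfold (F₁ τ +₁ id)

    roll∘τ≈id : roll ∘ τ ≈ id
    roll∘τ≈id = homomorphism-unique
      (trans sym-assoc (trans (unfold-homomorphism _) F₁+₁id-∘ ⟩∘⟨refl)) id-homomorphism

    τ∘roll≈id : τ ∘ roll ≈ id
    τ∘roll≈id = trans (unfold-homomorphism _)
      (trans F₁+₁id-∘ (trans (+₁-cong (F-resp-≈ roll∘τ≈id) refl) F₁id+₁id))

    α : Hom (F₀ T) T
    α = roll ∘ inl

    η : Hom Y T
    η = roll ∘ inr

    roll≈[α,η] : roll ≈ [ α , η ]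
    roll≈[α,η] = +-unique refl refl

    τ-injective : ∀ {X} {f g : Hom X T} → τ ∘ f ≈ τ ∘ g → f ≈ g
    τ-injective {f = f} {g} p = begin
      f              ≈⟨ cancelˡ roll∘τ≈id ⟨
      roll ∘ (τ ∘ f) ≈⟨ refl⟩∘⟨ p ⟩
      roll ∘ (τ ∘ g) ≈⟨ cancelˡ roll∘τ≈id ⟩
      g              ∎

    τ∘[α∘F₁s,id] : ∀ {X} {s : Hom X T} → τ ∘ [ α ∘ F₁ s , id ] ≈ [ inl ∘ F₁ s , τ ]
    τ∘[α∘F₁s,id] =
      trans ∘-[] ([]-cong (trans sym-assoc (cancelˡ τ∘roll≈id ⟩∘⟨refl)) identityʳ)

    τ-equation⇒solution : ∀ {X} {e : Hom X (F₀ X +₀ T)} {s : Hom X T} →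
                          τ ∘ s ≈ [ inl ∘ F₁ s , τ ] ∘ e → IsSolution α e s
    τ-equation⇒solution p =
      solution-fold (τ-injective (trans p (sym (trans sym-assoc (τ∘[α∘F₁s,id] ⟩∘⟨refl)))))

    solution⇒τ-equation : ∀ {X} {e : Hom X (F₀ X +₀ T)} {s : Hom X T} →
                          IsSolution α e s → τ ∘ s ≈ [ inl ∘ F₁ s , τ ] ∘ e
    solution⇒τ-equation p =
      trans (refl⟩∘⟨ solution-unfold p) (trans sym-assoc (τ∘[α∘F₁s,id] ⟩∘⟨refl))

    -- The coalgebra homomorphisms from equation-coalgebra e to τ are exactly the maps
    -- [ s , id ] with s a solution of e.
    equation-coalgebra : ∀ {X} → Hom X (F₀ X +₀ T) → Hom (X +₀ T) (F₀ (X +₀ T) +₀ Y)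
    equation-coalgebra e = [ [ inl ∘ F₁ inl , (F₁ inr +₁ id) ∘ τ ] ∘ e , (F₁ inr +₁ id) ∘ τ ]

    equation-coalgebra-action : ∀ {X} {e : Hom X (F₀ X +₀ T)} {g : Hom (X +₀ T) T} →
      g ∘ inr ≈ id →
      (F₁ g +₁ id) ∘ equation-coalgebra e ≈ [ [ inl ∘ F₁ (g ∘ inl) , τ ] ∘ e , τ ]
    equation-coalgebra-action g∘inr≈id = trans ∘-[] ([]-cong
      (trans sym-assoc (trans ∘-[] ([]-cong on-inl (F₁+₁id-cancelˡ g∘inr≈id)) ⟩∘⟨refl))
      (F₁+₁id-cancelˡ g∘inr≈id))
      where
      on-inl = trans (pullˡ inl-β) (pullʳ F₁-∘)

    unfold-equation-inr : ∀ {X} (e : Hom X (F₀ X +₀ T)) →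
                          unfold (equation-coalgebra e) ∘ inr ≈ id
    unfold-equation-inr e = homomorphism-unique
      (trans (pullˡ (unfold-homomorphism _)) (trans (pullʳ inr-β) (pullˡ F₁+₁id-∘)))
      id-homomorphism

    _‡ : ∀ {X} → Hom X (F₀ X +₀ T) → Hom X T
    e ‡ = unfold (equation-coalgebra e) ∘ inl

    ‡-solution : ∀ {X} (e : Hom X (F₀ X +₀ T)) → IsSolution α e (e ‡)
    ‡-solution e = τ-equation⇒solution (begin
      τ ∘ (unfold (equation-coalgebra e) ∘ inl)
        ≈⟨ pullˡ (unfold-homomorphism _) ⟩
      ((F₁ (unfold (equation-coalgebra e)) +₁ id) ∘ equation-coalgebra e) ∘ inl
        ≈⟨ equation-coalgebra-action (unfold-equation-inr e) ⟩∘⟨refl ⟩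
      [ [ inl ∘ F₁ (e ‡) , τ ] ∘ e , τ ] ∘ inl
        ≈⟨ inl-β ⟩
      [ inl ∘ F₁ (e ‡) , τ ] ∘ e ∎)

    ‡-unique : ∀ {X} {e : Hom X (F₀ X +₀ T)} {s : Hom X T} → IsSolution α e s → s ≈ e ‡
    ‡-unique {e = e} {s} p = trans (sym inl-β)
      (homomorphism-unique [s,id]-homomorphism (unfold-homomorphism _) ⟩∘⟨refl)
      where
      [s,id]-homomorphism : IsCoalgHom (equation-coalgebra e) τ [ s , id ]
      [s,id]-homomorphism = begin
        τ ∘ [ s , id ]
          ≈⟨ trans ∘-[] ([]-cong (solution⇒τ-equation p) identityʳ) ⟩
        [ [ inl ∘ F₁ s , τ ] ∘ e , τ ]
          ≈⟨ []-cong ([]-cong (refl⟩∘⟨ F-resp-≈ inl-β) refl ⟩∘⟨refl) refl ⟨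
        [ [ inl ∘ F₁ ([ s , id ] ∘ inl) , τ ] ∘ e , τ ]
          ≈⟨ equation-coalgebra-action inr-β ⟨
        (F₁ [ s , id ] +₁ id) ∘ equation-coalgebra e ∎

    elgot : CompleteElgot T
    elgot = CompleteIterative.elgot α _‡ ‡-solution ‡-unique

    free : IsFreeElgot Y T elgot η
    free = Retraction.free elgot η τ τ∘[α,η]≈id η•τ‡≈id
      where
      τ∘[α,η]≈id : τ ∘ [ α , η ] ≈ id
      τ∘[α,η]≈id = trans (refl⟩∘⟨ sym roll≈[α,η]) τ∘roll≈id
      η•τ‡≈id : (η • τ) ‡ ≈ id
      η•τ‡≈id = sym (‡-unique (solution-fold (begin
        id                                  ≈⟨ roll∘τ≈id ⟨
        roll ∘ τ                            ≈⟨ roll≈[α,η] ⟩∘⟨refl ⟩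
        [ α , η ] ∘ τ                       ≈⟨ []-cong (trans (refl⟩∘⟨ identity) identityʳ) refl ⟩∘⟨refl ⟨
        [ α ∘ F₁ id , η ] ∘ τ               ≈⟨ pullˡ []-∘-id+₁ ⟨
        [ α ∘ F₁ id , id ] ∘ (η • τ)        ∎)))

  module FreeElgot {Y T} (𝕋 : CompleteElgot T) (η : Hom Y T) (isFree : IsFreeElgot Y T 𝕋 η) where
    open CompleteElgot 𝕋
    open Unrolled 𝕋 η

    endomorphism-unique : ∀ {k : Hom T T} → IsSolutionPreserving 𝕋 𝕋 k → k ∘ η ≈ η → k ≈ id
    endomorphism-unique preserves k∘η≈η with isFree T 𝕋 η
    ... | _ , _ , unique =
      trans (sym (unique (preserves , k∘η≈η))) (unique (preserves-id 𝕋 , identityˡ))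

    unroll : Hom T (F₀ T +₀ Y)
    unroll = proj₁ (isFree _ unrolled inr)

    unroll-preserves : IsSolutionPreserving 𝕋 unrolled unroll
    unroll-preserves = proj₁ (proj₁ (proj₂ (isFree _ unrolled inr)))

    unroll∘η : unroll ∘ η ≈ inr
    unroll∘η = proj₂ (proj₁ (proj₂ (isFree _ unrolled inr)))

    roll∘unroll≈id : roll ∘ unroll ≈ id
    roll∘unroll≈id = endomorphism-unique
      (preserves-∘ 𝕋 unrolled 𝕋 roll-preserves unroll-preserves) (trans (pullʳ unroll∘η) inr-β)

    unroll∘roll≈id : unroll ∘ roll ≈ id
    unroll∘roll≈id = trans ∘-[] (trans ([]-cong unroll∘α unroll∘η) []-η)
      where
      unroll∘α : unroll ∘ α ≈ inl
      unroll∘α = begin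
        unroll ∘ α                 ≈⟨ preserves⇒homomorphism 𝕋 unrolled unroll-preserves ⟩
        β ∘ F₁ unroll              ≈⟨ β-∘-F₁ ⟩
        inl ∘ F₁ (roll ∘ unroll)   ≈⟨ refl⟩∘⟨ trans (F-resp-≈ roll∘unroll≈id) identity ⟩
        inl ∘ id                   ≈⟨ identityʳ ⟩
        inl                        ∎

    final : IsFinalCoalgebra Y T unroll
    final = R.final (endomorphism-unique (R.extend-preserves 𝕋 η) (R.extend-∘-η 𝕋 η))
      where module R = Retraction 𝕋 η unroll unroll∘roll≈id

theorem5p4 : ∀ {o ℓ e} (C : Category o ℓ e) (cop : FiniteCoproducts C)
               (H : Endofunctor C) (Y TY : Category.Obj C) →
               Elgot.FinalCoalgebraCarrier C cop H Y TY ⇔ Elgot.FreeElgotCarrier C cop H Y TY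
theorem5p4 C cop H Y TY = mk⇔
  (λ { (τ , isFinal) → let open FinalCoalgebra τ isFinal in elgot , η , free })
  (λ { (𝕋 , η , isFree) → let open FreeElgot 𝕋 η isFree in unroll , final })
  where open ElgotAlgebras cop H
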